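{- Let $G$ be a bipartite graph with bipartition $(B,C)$, and write its adjacency matrix and each spectral idempotent in block form with respect to $(B,C)$. If $E_\theta$ and $E_\tau$ are two distinct spectral idempotents of $A$ such that $E_\theta+E_\tau$ is zero on the off-diagonal blocks, then $E_\theta=E_{ -\tau}$.
   Context: $A$ is the adjacency matrix of $G$, with spectral decomposition $A=\sum_\theta\theta E_\theta$, where $E_\theta$ is the orthogonal projection onto the $\theta$-eigenspace (the spectral idempotent for $\theta$). For a bipartite graph, $-\theta$ is an eigenvalue whenever $\theta$ is. The off-diagonal blocks are the $B\times C$ and $C\times B$ blocks. -}

module Defs where

open import Level using (Level; _⊔_)
open import Data.Nat using (ℕ; zero; suc)
open import Data.Fin using (Fin; zero; suc)
open import Data.Bool using (Bool; true; false; if_then_else_)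
open import Data.Sum using (_⊎_)
open import Relation.Binary.PropositionalEquality using (_≡_; _≢_)
open import Relation.Nullary using (¬_)
open import Relation.Nullary.Decidable using (does)
open import Algebra.Bundles using (CommutativeRing)
open import Data.Fin.Properties using (_≟_)

record Graph (n : ℕ) : Set where
  field
    adj   : Fin n → Fin n → Bool
    symm  : ∀ x y → adj x y ≡ adj y x
    irrefl : ∀ x → adj x x ≡ false

-- A bipartition (B , C) given by a colouring: B = colour⁻¹ true, C = colour⁻¹ false;
-- every edge joins B to C.
IsBipartition : ∀ {n} → Graph n → (Fin n → Bool) → Set
IsBipartition G colour = ∀ x y → Graph.adj G x y ≡ true → colour x ≢ colour y

record IntegralDomainChar≠2 (c ℓ : Level) : Set (Level.suc (c ⊔ ℓ)) where
  field
    ring : CommutativeRing c ℓ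
  open CommutativeRing ring
  field
    noZeroDivisors : ∀ x y → x * y ≈ 0# → x ≈ 0# ⊎ y ≈ 0#
    nontrivial     : ¬ (1# ≈ 0#)
    two≉0          : ¬ (1# + 1# ≈ 0#)

module Matrices {c ℓ} (R : CommutativeRing c ℓ) where
  open CommutativeRing R hiding (zero)

  Matrix : ℕ → Set c
  Matrix n = Fin n → Fin n → Carrier

  sumF : ∀ {m} → (Fin m → Carrier) → Carrier
  sumF {zero}  f = 0#
  sumF {suc m} f = f zero + sumF (λ i → f (suc i))

  _⊗_ : ∀ {n} → Matrix n → Matrix n → Matrix n
  (M ⊗ N) x y = sumF (λ z → M x z * N z y)

  _⊕_ : ∀ {n} → Matrix n → Matrix n → Matrix n
  (M ⊕ N) x y = M x y + N x y

  _·_ : ∀ {n} → Carrier → Matrix n → Matrix n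
  (a · M) x y = a * M x y

  0M : ∀ {n} → Matrix n
  0M x y = 0#

  idM : ∀ {n} → Matrix n
  idM x y = if does (x ≟ y) then 1# else 0#

  _≈M_ : ∀ {n} → Matrix n → Matrix n → Set ℓ
  M ≈M N = ∀ x y → M x y ≈ N x y

  sumM : ∀ {n m} → (Fin m → Matrix n) → Matrix n
  sumM F x y = sumF (λ i → F i x y)

  transpose : ∀ {n} → Matrix n → Matrix n
  transpose M x y = M y x

  adjacencyMatrix : ∀ {n} → Graph n → Matrix n
  adjacencyMatrix G x y = if Graph.adj G x y then 1# else 0#

  -- The spectral decomposition A = Σ θ E_θ: distinct eigenvalues θ_i (i : Fin k),
  -- with E_i the (nonzero, symmetric = orthogonal) projections onto the eigenspaces,
  -- pairwise orthogonal and summing to the identity.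
  record SpectralDecomposition {n} (A : Matrix n) : Set (c ⊔ ℓ) where
    field
      k        : ℕ
      eig      : Fin k → Carrier
      E        : Fin k → Matrix n
      distinct : ∀ i j → i ≢ j → ¬ (eig i ≈ eig j)
      nonzero  : ∀ i → ¬ (E i ≈M 0M)
      symmetric : ∀ i → transpose (E i) ≈M E i
      idem     : ∀ i → (E i ⊗ E i) ≈M E i
      orth     : ∀ i j → i ≢ j → (E i ⊗ E j) ≈M 0M
      complete : sumM E ≈M idM
      decomp   : A ≈M sumM (λ i → eig i · E i)

{-# OPTIONS --safe #-}
-- Let D be the diagonal matrix with entries +1 on B and −1 on C.  Because every
-- edge joins B to C we have DAD = −A, so conjugation by D sends the τ-eigenspace
-- projection E_τ to a (−τ)-eigenmatrix, and E_θ (D E_τ D) can only be nonzero when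
-- θ = −τ.  If E_θ + E_τ vanishes on the off-diagonal blocks it commutes with D, so
--   E_θ = E_θ (E_θ + E_τ) = E_θ (D E_θ D) + E_θ (D E_τ D).
-- Over an integral domain a nonzero matrix can only be annihilated by the scalar 0,
-- so since E_θ ≠ 0, either θ = −τ or θ = −θ, i.e. θ = 0 (as 2 ≠ 0); by symmetry
-- also τ = −θ or τ = 0, and in every case θ = −τ.
module Submission where

open import Defs
open import Data.Nat using (ℕ; zero; suc)
open import Data.Fin using (Fin; zero; suc; punchIn)
open import Data.Fin.Properties using (punchInᵢ≢i)
open import Data.Bool using (Bool; true; false; if_then_else_)
open import Data.Bool.Properties using () renaming (_≟_ to _≟ᵇ_)
open import Data.Product using (Σ; _×_; _,_)
open import Data.Sum using (_⊎_; inj₁; inj₂; map₁)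
open import Data.Empty using (⊥-elim)
open import Function using (_∘_)
open import Relation.Nullary using (yes; no)
open import Relation.Binary.PropositionalEquality as ≡ using (_≡_; _≢_)
open import Algebra.Bundles using (CommutativeRing)

∀-⊎-Fin : ∀ {m a b} {A : Set a} {Q : Fin m → Set b} →
          (∀ i → A ⊎ Q i) → A ⊎ (∀ i → Q i)
∀-⊎-Fin {zero}  h = inj₂ λ ()
∀-⊎-Fin {suc m} h with h zero | ∀-⊎-Fin (h ∘ suc)
... | inj₁ a  | _       = inj₁ a
... | inj₂ q₀ | inj₁ a  = inj₁ a
... | inj₂ q₀ | inj₂ qs = inj₂ λ { zero → q₀ ; (suc i) → qs i }

module MatrixAlgebra {c ℓ} (R : CommutativeRing c ℓ) where
  open CommutativeRing R hiding (zero)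
  open Matrices R
  open import Algebra.Properties.Semiring.Sum semiring
    using (sum; sum-cong-≋; sum-remove; sum-replicate-zero; ∑-distrib-+; ∑-comm;
           *-distribˡ-sum; *-distribʳ-sum)
  open import Algebra.Properties.CommutativeSemigroup *-commutativeSemigroup
    using (x∙yz≈y∙xz)
  open import Relation.Binary.Reasoning.Setoid setoid

  sumF≈sum : ∀ {m} (f : Fin m → Carrier) → sumF f ≈ sum f
  sumF≈sum {zero}  f = refl
  sumF≈sum {suc m} f = +-congˡ (sumF≈sum (f ∘ suc))

  sumF-cong : ∀ {m} {f g : Fin m → Carrier} → (∀ i → f i ≈ g i) → sumF f ≈ sumF g
  sumF-cong {f = f} {g} f≈g = begin
    sumF f  ≈⟨ sumF≈sum f ⟩
    sum f   ≈⟨ sum-cong-≋ f≈g ⟩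
    sum g   ≈⟨ sumF≈sum g ⟨
    sumF g  ∎

  sumF-distrib-+ : ∀ {m} (f g : Fin m → Carrier) →
                   sumF (λ i → f i + g i) ≈ sumF f + sumF g
  sumF-distrib-+ f g = begin
    sumF (λ i → f i + g i)  ≈⟨ sumF≈sum (λ i → f i + g i) ⟩
    sum (λ i → f i + g i)   ≈⟨ ∑-distrib-+ f g ⟩
    sum f + sum g           ≈⟨ +-cong (sumF≈sum f) (sumF≈sum g) ⟨
    sumF f + sumF g         ∎

  *-distribˡ-sumF : ∀ {m} x (f : Fin m → Carrier) → x * sumF f ≈ sumF (λ i → x * f i)
  *-distribˡ-sumF x f = begin
    x * sumF f            ≈⟨ *-congˡ (sumF≈sum f) ⟩
    x * sum f             ≈⟨ *-distribˡ-sum x f ⟩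
    sum (λ i → x * f i)   ≈⟨ sumF≈sum (λ i → x * f i) ⟨
    sumF (λ i → x * f i)  ∎

  *-distribʳ-sumF : ∀ {m} x (f : Fin m → Carrier) → sumF f * x ≈ sumF (λ i → f i * x)
  *-distribʳ-sumF x f = begin
    sumF f * x            ≈⟨ *-congʳ (sumF≈sum f) ⟩
    sum f * x             ≈⟨ *-distribʳ-sum x f ⟩
    sum (λ i → f i * x)   ≈⟨ sumF≈sum (λ i → f i * x) ⟨
    sumF (λ i → f i * x)  ∎

  sumF-comm : ∀ {m p} (f : Fin m → Fin p → Carrier) →
              sumF (λ i → sumF (f i)) ≈ sumF (λ j → sumF (λ i → f i j))
  sumF-comm f = begin
    sumF (λ i → sumF (f i))             ≈⟨ sumF≈sum (λ i → sumF (f i)) ⟩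
    sum (λ i → sumF (f i))              ≈⟨ sum-cong-≋ (λ i → sumF≈sum (f i)) ⟩
    sum (λ i → sum (f i))               ≈⟨ ∑-comm f ⟩
    sum (λ j → sum (λ i → f i j))       ≈⟨ sum-cong-≋ (λ j → sumF≈sum (λ i → f i j)) ⟨
    sum (λ j → sumF (λ i → f i j))      ≈⟨ sumF≈sum (λ j → sumF (λ i → f i j)) ⟨
    sumF (λ j → sumF (λ i → f i j))     ∎

  sumF-delta : ∀ {m} (f : Fin m → Carrier) i → (∀ j → j ≢ i → f j ≈ 0#) → sumF f ≈ f i
  sumF-delta {suc m} f i f≈0 = begin
    sumF f                          ≈⟨ sumF≈sum f ⟩
    sum f                           ≈⟨ sum-remove {i = i} f ⟩
    f i + sum (f ∘ punchIn i)       ≈⟨ +-congˡ (sum-cong-≋ {m} (λ j → f≈0 _ (punchInᵢ≢i i j))) ⟩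
    f i + sum {m} (λ _ → 0#)        ≈⟨ +-congˡ (sum-replicate-zero m) ⟩
    f i + 0#                        ≈⟨ +-identityʳ (f i) ⟩
    f i                             ∎

  module _ {n : ℕ} where

    ≈M-sym : {M N : Matrix n} → M ≈M N → N ≈M M
    ≈M-sym M≈N x y = sym (M≈N x y)

    ⊗-congˡ : (M : Matrix n) {N N′ : Matrix n} → N ≈M N′ → (M ⊗ N) ≈M (M ⊗ N′)
    ⊗-congˡ M N≈N′ x y = sumF-cong {n} λ z → *-congˡ (N≈N′ z y)

    ⊗-congʳ : (N : Matrix n) {M M′ : Matrix n} → M ≈M M′ → (M ⊗ N) ≈M (M′ ⊗ N)
    ⊗-congʳ N M≈M′ x y = sumF-cong {n} λ z → *-congʳ (M≈M′ x z)

    ⊗-assoc : (M N P : Matrix n) → ((M ⊗ N) ⊗ P) ≈M (M ⊗ (N ⊗ P))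
    ⊗-assoc M N P x y = begin
      sumF (λ z → sumF (λ w → M x w * N w z) * P z y)
        ≈⟨ sumF-cong {n} (λ z → *-distribʳ-sumF (P z y) (λ w → M x w * N w z)) ⟩
      sumF (λ z → sumF (λ w → (M x w * N w z) * P z y))
        ≈⟨ sumF-comm (λ z w → (M x w * N w z) * P z y) ⟩
      sumF (λ w → sumF (λ z → (M x w * N w z) * P z y))
        ≈⟨ sumF-cong {n} (λ w → sumF-cong {n} (λ z → *-assoc (M x w) _ _)) ⟩
      sumF (λ w → sumF (λ z → M x w * (N w z * P z y)))
        ≈⟨ sumF-cong {n} (λ w → *-distribˡ-sumF (M x w) (λ z → N w z * P z y)) ⟨
      sumF (λ w → M x w * sumF (λ z → N w z * P z y))
        ∎

    ⊗-distribˡ-⊕ : (M N P : Matrix n) → (M ⊗ (N ⊕ P)) ≈M ((M ⊗ N) ⊕ (M ⊗ P))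
    ⊗-distribˡ-⊕ M N P x y =
      trans (sumF-cong {n} λ z → distribˡ (M x z) _ _)
            (sumF-distrib-+ (λ z → M x z * N z y) (λ z → M x z * P z y))

    ·-⊗ : ∀ a (M N : Matrix n) → ((a · M) ⊗ N) ≈M (a · (M ⊗ N))
    ·-⊗ a M N x y = trans (sumF-cong {n} λ z → *-assoc a _ _)
                          (sym (*-distribˡ-sumF a (λ z → M x z * N z y)))

    ⊗-· : ∀ a (M N : Matrix n) → (M ⊗ (a · N)) ≈M (a · (M ⊗ N))
    ⊗-· a M N x y = trans (sumF-cong {n} λ z → x∙yz≈y∙xz (M x z) a _)
                          (sym (*-distribˡ-sumF a (λ z → M x z * N z y)))

    ⊗-sumM : ∀ {k} (M : Matrix n) (F : Fin k → Matrix n) →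
             (M ⊗ sumM F) ≈M sumM (λ i → M ⊗ F i)
    ⊗-sumM M F x y =
      trans (sumF-cong {n} λ z → *-distribˡ-sumF (M x z) (λ i → F i z y))
            (sumF-comm λ z i → M x z * F i z y)

    transpose-⊗ : (M N : Matrix n) → transpose (M ⊗ N) ≈M (transpose N ⊗ transpose M)
    transpose-⊗ M N x y = sumF-cong {n} λ z → *-comm (M y z) (N z x)

    ⊗-intertwine : ∀ {a b} {M A N : Matrix n} →
                   (M ⊗ A) ≈M (a · M) → (A ⊗ N) ≈M (b · N) →
                   (a · (M ⊗ N)) ≈M (b · (M ⊗ N))
    ⊗-intertwine {a} {b} {M} {A} {N} MA≈aM AN≈bN x y = begin
      a * (M ⊗ N) x y        ≈⟨ ·-⊗ a M N x y ⟨
      ((a · M) ⊗ N) x y      ≈⟨ ⊗-congʳ N (≈M-sym MA≈aM) x y ⟩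
      ((M ⊗ A) ⊗ N) x y      ≈⟨ ⊗-assoc M A N x y ⟩
      (M ⊗ (A ⊗ N)) x y      ≈⟨ ⊗-congˡ M AN≈bN x y ⟩
      (M ⊗ (b · N)) x y      ≈⟨ ⊗-· b M N x y ⟩
      b * (M ⊗ N) x y        ∎

    adjacency-symmetric : (G : Graph n) →
                          transpose (adjacencyMatrix G) ≈M adjacencyMatrix G
    adjacency-symmetric G x y =
      reflexive (≡.cong (λ b → if b then 1# else 0#) (Graph.symm G y x))

module SpectralProperties {c ℓ} (R : CommutativeRing c ℓ) {n}
       {A : Matrices.Matrix R n} (S : Matrices.SpectralDecomposition R A) where
  open CommutativeRing R hiding (zero)
  open Matrices R
  open MatrixAlgebra R
  open SpectralDecomposition S
  open import Relation.Binary.Reasoning.Setoid setoid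

  E-⊗-A : ∀ i → (E i ⊗ A) ≈M (eig i · E i)
  E-⊗-A i x y = begin
    (E i ⊗ A) x y                              ≈⟨ ⊗-congˡ (E i) decomp x y ⟩
    (E i ⊗ sumM (λ j → eig j · E j)) x y       ≈⟨ ⊗-sumM (E i) (λ j → eig j · E j) x y ⟩
    sumF (λ j → (E i ⊗ (eig j · E j)) x y)     ≈⟨ sumF-cong (λ j → ⊗-· (eig j) (E i) (E j) x y) ⟩
    sumF (λ j → eig j * (E i ⊗ E j) x y)       ≈⟨ sumF-delta _ i E-orth ⟩
    eig i * (E i ⊗ E i) x y                    ≈⟨ *-congˡ (idem i x y) ⟩
    eig i * E i x y                            ∎
    where
    E-orth : ∀ j → j ≢ i → eig j * (E i ⊗ E j) x y ≈ 0#
    E-orth j j≢i = trans (*-congˡ (orth i j (j≢i ∘ ≡.sym) x y)) (zeroʳ (eig j))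

  A-⊗-E : transpose A ≈M A → ∀ j → (A ⊗ E j) ≈M (eig j · E j)
  A-⊗-E A-symm j x y = begin
    (A ⊗ E j) x y                              ≈⟨ transpose-⊗ A (E j) y x ⟩
    (transpose (E j) ⊗ transpose A) y x        ≈⟨ ⊗-congʳ (transpose A) (symmetric j) y x ⟩
    (E j ⊗ transpose A) y x                    ≈⟨ ⊗-congˡ (E j) A-symm y x ⟩
    (E j ⊗ A) y x                              ≈⟨ E-⊗-A j y x ⟩
    eig j * E j y x                            ≈⟨ *-congˡ (symmetric j x y) ⟩
    eig j * E j x y                            ∎

module Bipartite {c ℓ} (R : CommutativeRing c ℓ) {n} (colour : Fin n → Bool) where
  open CommutativeRing R hiding (zero)
  open Matrices R
  open MatrixAlgebra R
  open import Algebra.Properties.Ring ring using (-1*x≈-x; -‿distribˡ-*; -‿distribʳ-*)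
  open import Algebra.Properties.Group +-group using (ε⁻¹≈ε; ⁻¹-involutive)
  open import Algebra.Properties.CommutativeSemigroup *-commutativeSemigroup
    using (x∙yz≈y∙xz)
  open import Relation.Binary.Reasoning.Setoid setoid

  sign : Bool → Carrier
  sign true  = 1#
  sign false = - 1#

  sign-square : ∀ b → sign b * sign b ≈ 1#
  sign-square true  = *-identityˡ 1#
  sign-square false = trans (-1*x≈-x (- 1#)) (⁻¹-involutive 1#)

  sign-opposite : ∀ {b b′} → b ≢ b′ → sign b′ ≈ - sign b
  sign-opposite {true}  {true}  b≢b′ = ⊥-elim (b≢b′ ≡.refl)
  sign-opposite {true}  {false} b≢b′ = refl
  sign-opposite {false} {true}  b≢b′ = sym (⁻¹-involutive 1#)
  sign-opposite {false} {false} b≢b′ = ⊥-elim (b≢b′ ≡.refl)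

  DiagonalBlocksVanish : Matrix n → Set ℓ
  DiagonalBlocksVanish M = ∀ x y → colour x ≡ colour y → M x y ≈ 0#

  OffDiagonalBlocksVanish : Matrix n → Set ℓ
  OffDiagonalBlocksVanish M = ∀ x y → colour x ≢ colour y → M x y ≈ 0#

  d : Fin n → Carrier
  d x = sign (colour x)

  signConj : Matrix n → Matrix n
  signConj M x y = d x * (M x y * d y)

  signConj-⊕ : (M N : Matrix n) → signConj (M ⊕ N) ≈M (signConj M ⊕ signConj N)
  signConj-⊕ M N x y = trans (*-congˡ (distribʳ _ (M x y) (N x y))) (distribˡ _ _ _)

  signConj-blockDiagonal : ∀ M → OffDiagonalBlocksVanish M → signConj M ≈M M
  signConj-blockDiagonal M M-off x y with colour x ≟ᵇ colour y
  ... | yes cx≡cy = begin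
    d x * (M x y * d y)  ≈⟨ *-congˡ (*-congˡ (reflexive (≡.cong sign (≡.sym cx≡cy)))) ⟩
    d x * (M x y * d x)  ≈⟨ x∙yz≈y∙xz (d x) (M x y) (d x) ⟩
    M x y * (d x * d x)  ≈⟨ *-congˡ (sign-square (colour x)) ⟩
    M x y * 1#           ≈⟨ *-identityʳ (M x y) ⟩
    M x y                ∎
  ... | no cx≢cy = begin
    d x * (M x y * d y)  ≈⟨ *-congˡ (*-congʳ Mxy≈0) ⟩
    d x * (0# * d y)     ≈⟨ *-congˡ (zeroˡ (d y)) ⟩
    d x * 0#             ≈⟨ zeroʳ (d x) ⟩
    0#                   ≈⟨ Mxy≈0 ⟨
    M x y                ∎
    where
    Mxy≈0 : M x y ≈ 0#
    Mxy≈0 = M-off x y cx≢cy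

  sign-anticommutes : ∀ {M} → DiagonalBlocksVanish M →
                      ∀ x z → M x z * d z ≈ - (d x * M x z)
  sign-anticommutes {M} M-diag x z with colour x ≟ᵇ colour z
  ... | yes cx≡cz = begin
    M x z * d z      ≈⟨ *-congʳ Mxz≈0 ⟩
    0# * d z         ≈⟨ zeroˡ (d z) ⟩
    0#               ≈⟨ ε⁻¹≈ε ⟨
    - 0#             ≈⟨ -‿cong (trans (*-congˡ Mxz≈0) (zeroʳ (d x))) ⟨
    - (d x * M x z)  ∎
    where
    Mxz≈0 : M x z ≈ 0#
    Mxz≈0 = M-diag x z cx≡cz
  ... | no cx≢cz = begin
    M x z * d z     ≈⟨ *-congˡ (sign-opposite cx≢cz) ⟩
    M x z * - d x   ≈⟨ -‿distribʳ-* (M x z) _ ⟨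
    - (M x z * d x) ≈⟨ -‿cong (*-comm (M x z) _) ⟩
    - (d x * M x z) ∎

  signConj-negates-eigenvalue : ∀ {a} {M N : Matrix n} → DiagonalBlocksVanish M →
                                (M ⊗ N) ≈M (a · N) → (M ⊗ signConj N) ≈M ((- a) · signConj N)
  signConj-negates-eigenvalue {a} {M} {N} M-diag MN≈aN x y = begin
    sumF (λ z → M x z * (d z * (N z y * d y)))
      ≈⟨ sumF-cong move-sign ⟩
    sumF (λ z → - d x * ((M x z * N z y) * d y))
      ≈⟨ *-distribˡ-sumF (- d x) (λ z → (M x z * N z y) * d y) ⟨
    - d x * sumF (λ z → (M x z * N z y) * d y)
      ≈⟨ *-congˡ (*-distribʳ-sumF (d y) (λ z → M x z * N z y)) ⟨
    - d x * ((M ⊗ N) x y * d y)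
      ≈⟨ *-congˡ (*-congʳ (MN≈aN x y)) ⟩
    - d x * ((a * N x y) * d y)
      ≈⟨ swap-sign ⟩
    - a * (d x * (N x y * d y))
      ∎
    where
    move-sign : ∀ z → M x z * (d z * (N z y * d y)) ≈ - d x * ((M x z * N z y) * d y)
    move-sign z = begin
      M x z * (d z * (N z y * d y))     ≈⟨ *-assoc (M x z) _ _ ⟨
      (M x z * d z) * (N z y * d y)     ≈⟨ *-congʳ (sign-anticommutes M-diag x z) ⟩
      - (d x * M x z) * (N z y * d y)   ≈⟨ *-congʳ (-‿distribˡ-* (d x) _) ⟩
      (- d x * M x z) * (N z y * d y)   ≈⟨ *-assoc (- d x) _ _ ⟩
      - d x * (M x z * (N z y * d y))   ≈⟨ *-congˡ (*-assoc (M x z) _ _) ⟨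
      - d x * ((M x z * N z y) * d y)   ∎

    swap-sign : - d x * ((a * N x y) * d y) ≈ - a * (d x * (N x y * d y))
    swap-sign = begin
      - d x * ((a * N x y) * d y)    ≈⟨ -‿distribˡ-* (d x) _ ⟨
      - (d x * ((a * N x y) * d y))  ≈⟨ -‿cong (*-congˡ (*-assoc a _ _)) ⟩
      - (d x * (a * (N x y * d y)))  ≈⟨ -‿cong (x∙yz≈y∙xz (d x) a _) ⟩
      - (a * (d x * (N x y * d y)))  ≈⟨ -‿distribˡ-* a _ ⟩
      - a * (d x * (N x y * d y))    ∎

  adjacency-diagonalBlocksVanish : (G : Graph n) → IsBipartition G colour →
                                   DiagonalBlocksVanish (adjacencyMatrix G)
  adjacency-diagonalBlocksVanish G bip x y cx≡cy with Graph.adj G x y in adj≡true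
  ... | true  = ⊥-elim (bip x y adj≡true cx≡cy)
  ... | false = refl

module IntegralDomainProperties {c ℓ} (K : IntegralDomainChar≠2 c ℓ) where
  open IntegralDomainChar≠2 K using (noZeroDivisors; two≉0) renaming (ring to R)
  open CommutativeRing R hiding (zero)
  open Matrices R
  open import Algebra.Properties.Ring ring using ([y-z]x≈yx-zx)
  open import Algebra.Properties.Group +-group using (x≈y⇒x∙y⁻¹≈ε; x∙y⁻¹≈ε⇒x≈y)
  open import Relation.Binary.Reasoning.Setoid setoid

  ·-cancelʳ-or-zero : ∀ {n a b} {X : Matrix n} → (a · X) ≈M (b · X) → a ≈ b ⊎ X ≈M 0M
  ·-cancelʳ-or-zero {a = a} {b} {X} aX≈bX =
    ∀-⊎-Fin λ x → ∀-⊎-Fin λ y → map₁ (x∙y⁻¹≈ε⇒x≈y a b) (noZeroDivisors _ _ (begin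
      (a - b) * X x y        ≈⟨ [y-z]x≈yx-zx (X x y) a b ⟩
      a * X x y - b * X x y  ≈⟨ x≈y⇒x∙y⁻¹≈ε (aX≈bX x y) ⟩
      0#                     ∎))

  x≈-x⇒x≈0 : ∀ {x} → x ≈ - x → x ≈ 0#
  x≈-x⇒x≈0 {x} x≈-x with noZeroDivisors (1# + 1#) x (begin
      (1# + 1#) * x   ≈⟨ distribʳ x 1# 1# ⟩
      1# * x + 1# * x ≈⟨ +-cong (*-identityˡ x) (*-identityˡ x) ⟩
      x + x           ≈⟨ +-congʳ x≈-x ⟩
      - x + x         ≈⟨ -‿inverseˡ x ⟩
      0#              ∎)
  ... | inj₁ 2≈0 = ⊥-elim (two≉0 2≈0)
  ... | inj₂ x≈0 = x≈0

module _ {c ℓ} (R : CommutativeRing c ℓ) where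
  open CommutativeRing R hiding (zero)
  open import Algebra.Properties.Group +-group using (ε⁻¹≈ε; ⁻¹-involutive)

  opposite-unless-zero : ∀ {x y} → x ≈ - y ⊎ x ≈ 0# → y ≈ - x ⊎ y ≈ 0# → x ≈ - y
  opposite-unless-zero (inj₁ x≈-y) _           = x≈-y
  opposite-unless-zero (inj₂ _)    (inj₁ y≈-x) = sym (trans (-‿cong y≈-x) (⁻¹-involutive _))
  opposite-unless-zero (inj₂ x≈0)  (inj₂ y≈0)  = trans x≈0 (trans (sym ε⁻¹≈ε) (-‿cong (sym y≈0)))

module BipartiteSpectrum {c ℓ} (K : IntegralDomainChar≠2 c ℓ) {n} (G : Graph n)
       (colour : Fin n → Bool) (bip : IsBipartition G colour) where
  open IntegralDomainChar≠2 K using () renaming (ring to R)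
  open CommutativeRing R hiding (zero)
  open Matrices R
  open MatrixAlgebra R
  open Bipartite R colour
  open IntegralDomainProperties K

  module _ (S : SpectralDecomposition (adjacencyMatrix G)) where
    open SpectralDecomposition S
    open SpectralProperties R S
    open import Relation.Binary.Reasoning.Setoid setoid

    E-⊗-signConj-eigen : ∀ i j → (eig i · (E i ⊗ signConj (E j))) ≈M
                                 ((- eig j) · (E i ⊗ signConj (E j)))
    E-⊗-signConj-eigen i j = ⊗-intertwine (E-⊗-A i)
      (signConj-negates-eigenvalue (adjacency-diagonalBlocksVanish G bip)
                                   (A-⊗-E (adjacency-symmetric G) j))

    E-split : ∀ {i j} → i ≢ j → OffDiagonalBlocksVanish (E i ⊕ E j) →
              E i ≈M ((E i ⊗ signConj (E i)) ⊕ (E i ⊗ signConj (E j)))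
    E-split {i} {j} i≢j off x y = begin
      E i x y
        ≈⟨ +-identityʳ (E i x y) ⟨
      E i x y + 0#
        ≈⟨ +-cong (idem i x y) (orth i j i≢j x y) ⟨
      ((E i ⊗ E i) ⊕ (E i ⊗ E j)) x y
        ≈⟨ ⊗-distribˡ-⊕ (E i) (E i) (E j) x y ⟨
      (E i ⊗ (E i ⊕ E j)) x y
        ≈⟨ ⊗-congˡ (E i) (≈M-sym (signConj-blockDiagonal (E i ⊕ E j) off)) x y ⟩
      (E i ⊗ signConj (E i ⊕ E j)) x y
        ≈⟨ ⊗-congˡ (E i) (signConj-⊕ (E i) (E j)) x y ⟩
      (E i ⊗ (signConj (E i) ⊕ signConj (E j))) x y
        ≈⟨ ⊗-distribˡ-⊕ (E i) (signConj (E i)) (signConj (E j)) x y ⟩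
      ((E i ⊗ signConj (E i)) ⊕ (E i ⊗ signConj (E j))) x y
        ∎

    eigenvalue-dichotomy : ∀ {i j} → i ≢ j → OffDiagonalBlocksVanish (E i ⊕ E j) →
                           eig i ≈ - eig j ⊎ eig i ≈ 0#
    eigenvalue-dichotomy {i} {j} i≢j off
      with ·-cancelʳ-or-zero (E-⊗-signConj-eigen i j)
    ... | inj₁ eigᵢ≈-eigⱼ = inj₁ eigᵢ≈-eigⱼ
    ... | inj₂ cross≈0 with ·-cancelʳ-or-zero (E-⊗-signConj-eigen i i)
    ...   | inj₁ eigᵢ≈-eigᵢ = inj₂ (x≈-x⇒x≈0 eigᵢ≈-eigᵢ)
    ...   | inj₂ self≈0 = ⊥-elim (nonzero i λ x y → begin
            E i x y  ≈⟨ E-split i≢j off x y ⟩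
            _        ≈⟨ +-cong (self≈0 x y) (cross≈0 x y) ⟩
            0# + 0#  ≈⟨ +-identityʳ 0# ⟩
            0#       ∎)

    eigenvalues-opposite : ∀ {i j} → i ≢ j → OffDiagonalBlocksVanish (E i ⊕ E j) →
                           eig i ≈ - eig j
    eigenvalues-opposite i≢j off = opposite-unless-zero R
      (eigenvalue-dichotomy i≢j off)
      (eigenvalue-dichotomy (i≢j ∘ ≡.sym) λ x y cx≢cy → trans (+-comm _ _) (off x y cx≢cy))

mainTheorem2 : ∀ {c ℓ} (K : IntegralDomainChar≠2 c ℓ) →
    let R = IntegralDomainChar≠2.ring K in
    let open CommutativeRing R hiding (zero) in
    let open Matrices R in
    ∀ {n} (G : Graph n) (colour : Fin n → Bool) → IsBipartition G colour →
    (S : SpectralDecomposition (adjacencyMatrix G)) →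
    let open SpectralDecomposition S in
    ∀ (θ τ : Fin k) → θ ≢ τ →
    (∀ x y → colour x ≢ colour y → (E θ ⊕ E τ) x y ≈ 0#) →
    Σ (Fin k) (λ σ → (eig σ ≈ - eig τ) × (E θ ≈M E σ))
mainTheorem2 K G colour bip S θ τ θ≢τ off =
  θ , eigenvalues-opposite S θ≢τ off , λ _ _ → refl
  where
  open CommutativeRing (IntegralDomainChar≠2.ring K) using (refl)
  open BipartiteSpectrum K G colour bip
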